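{- Let $r\geq 1$ and $n\geq 0$ be integers. Let $A(n,r)$ be the set of partitions of $n$ in which every part occurring with odd multiplicity occurs at least $2r+1$ times, and let $C(n,r)$ be the set of partitions of $n$ in which every odd part is congruent to $2r+1 \pmod{4r+2}$. Define $\beta_r$ on $A(n,r)$ as follows. For $\lambda=(\lambda_1^{m_1},\lambda_2^{m_2},\ldots)\in A(n,r)$ (multiplicity notation, distinct parts $\lambda_i$ with multiplicities $m_i$), assign to each $\lambda_i^{m_i}$ a multiset of parts: (i) if $\lambda_i$ is even: if $m_i\equiv 2v+1 \pmod{2r+1}$ with $0\le v\le r-1$, assign $\lambda_i$ with multiplicity $m_i-(2r+2v+2)$ together with $2\lambda_i$ with multiplicity $r+v+1$; if $m_i\equiv 2v\pmod{2r+1}$ with $0\le v\le r$, assign $\lambda_i$ with multiplicity $m_i-2v$ together with $2\lambda_i$ with multiplicity $v$; (ii) if $\lambda_i$ is odd: if $m_i\equiv 2v+1 \pmod{2r+1}$ with $0\le v\le r-1$, assign $(2r+1)\lambda_i$ with multiplicity $\frac{m_i-(2r+2v+2)}{2r+1}$ together with $2\lambda_i$ with multiplicity $r+v+1$; if $m_i\equiv 2v\pmod{2r+1}$ with $0\le v\le r$, assign $(2r+1)\lambda_i$ with multiplicity $\frac{m_i-2v}{2r+1}$ together with $2\lambda_i$ with multiplicity $v$. Let $\beta_r(\lambda)$ be the multiset union over all $i$ of these assigned multisets. Then $\beta_r$ is a bijection from $A(n,r)$ onto $C(n,r)$.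
   Context: A partition of $n$ is a finite non-increasing sequence of positive integers summing to $n$; it is viewed as a multiset of parts, and the union of partitions means multiset union (multiplicities add). Multiplicity notation $(\lambda_1^{m_1},\lambda_2^{m_2},\ldots)$ lists each distinct part $\lambda_i$ with the number $m_i$ of times it occurs. -}

module Defs where

open import Data.Nat using (ℕ; zero; suc; _+_; _*_; _∸_; _≤_; _<_; _≥_; _≟_; _≤?_)
open import Data.Nat.DivMod using (_%_; _/_)
open import Data.List using (List; []; _∷_; _++_; replicate; filter; length; concatMap; deduplicate)
open import Data.Nat.ListAction using (sum)
open import Data.List.Relation.Unary.All using (All)
open import Data.List.Relation.Unary.Linked using (Linked)
open import Data.List.Membership.Propositional using (_∈_)
open import Data.Product using (_×_)
open import Relation.Binary.PropositionalEquality using (_≡_)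
open import Relation.Nullary using (yes; no)

IsPartition : ℕ → List ℕ → Set
IsPartition n l = Linked _≥_ l × All (0 <_) l × sum l ≡ n

mult : ℕ → List ℕ → ℕ
mult k l = length (filter (_≟ k) l)

IsOdd : ℕ → Set
IsOdd m = m % 2 ≡ 1

InA : ℕ → ℕ → List ℕ → Set
InA n r l = IsPartition n l × (∀ k → k ∈ l → IsOdd (mult k l) → suc (2 * r) ≤ mult k l)

InC : ℕ → ℕ → List ℕ → Set
InC n r l = IsPartition n l × (∀ k → k ∈ l → IsOdd k → k % suc (suc (4 * r)) ≡ suc (2 * r))

-- the multiset assigned to a block λᵢ^{mᵢ} (part k, multiplicity m)
-- s = m mod (2r+1), v = ⌊s/2⌋ ; s = 2v+1 (odd case) or s = 2v (even case)
assign : ℕ → ℕ → ℕ → List ℕ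
assign r k m with k % 2 | m % suc (2 * r) % 2
... | 0 | 1 = replicate (m ∸ (2 * r + 2 * v + 2)) k ++ replicate (r + v + 1) (2 * k)
  where v = m % suc (2 * r) / 2
... | 0 | _ = replicate (m ∸ 2 * v) k ++ replicate v (2 * k)
  where v = m % suc (2 * r) / 2
... | _ | 1 = replicate ((m ∸ (2 * r + 2 * v + 2)) / suc (2 * r)) (suc (2 * r) * k)
              ++ replicate (r + v + 1) (2 * k)
  where v = m % suc (2 * r) / 2
... | _ | _ = replicate ((m ∸ 2 * v) / suc (2 * r)) (suc (2 * r) * k) ++ replicate v (2 * k)
  where v = m % suc (2 * r) / 2

insertDesc : ℕ → List ℕ → List ℕ
insertDesc x [] = x ∷ []
insertDesc x (y ∷ ys) with y ≤? x
... | yes _ = x ∷ y ∷ ys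
... | no _ = y ∷ insertDesc x ys

sortDesc : List ℕ → List ℕ
sortDesc [] = []
sortDesc (x ∷ xs) = insertDesc x (sortDesc xs)

β : ℕ → List ℕ → List ℕ
β r l = sortDesc (concatMap (λ k → assign r k (mult k l)) (deduplicate _≟_ l))

-- Every admissible multiplicity m (odd m only if m ≥ 2r+1) is uniquely m = (2r+1)c + 2d with
-- 0 ≤ d ≤ 2r; admissibility is exactly what keeps c ≥ 0 when m mod (2r+1) is odd. β sends the block
-- λ^m to d copies of 2λ together with (2r+1)c copies of λ (λ even) or c copies of (2r+1)λ (λ odd),
-- which preserves the sum. In the image, 2j has multiplicity (2r+1)c_{2j} + d_j, an odd (2r+1)k with
-- k odd has multiplicity c_k, and no other odd part occurs. Since d_j < 2r+1, division with remainder
-- recovers every c and d, hence the original multiplicities; conversely, the c's and d's read off any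
-- μ ∈ C(n,r) define admissible multiplicities of a partition that β maps to μ.

module Submission where

open import Defs
open import Data.Nat
open import Data.Nat.Properties
open import Algebra.Properties.CommutativeSemigroup +-commutativeSemigroup
  using (interchange; x∙yz≈y∙xz; xy∙z≈x∙zy)
open import Data.Nat.DivMod
open import Data.Nat.ListAction using (sum)
open import Data.Nat.ListAction.Properties using (sum-++; sum-↭)
open import Data.Nat.Tactic.RingSolver using (solve-∀)
open import Data.List using (List; []; _∷_; [_]; _++_; replicate; filter; length; map; concatMap; deduplicate)
open import Data.List.Properties using (filter-++; filter-accept; filter-reject; length-++; map-id; map-cong; map-cong-local)
open import Data.List.Membership.Propositional using (_∈_)
open import Data.List.Relation.Binary.Permutation.Propositional
  using (_↭_; ↭-refl; ↭-trans; prep; swap)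
open import Data.List.Relation.Binary.Permutation.Propositional.Properties using (↭-length; filter-↭)
open import Data.List.Relation.Unary.All as All using (All; []; _∷_)
open import Data.List.Relation.Unary.All.Properties using (all-filter; ++⁺; replicate⁺)
open import Data.List.Relation.Unary.Any using (here; there)
open import Data.List.Relation.Unary.Linked as Linked using (Linked; []; [-]; _∷_)
open import Data.List.Relation.Unary.Linked.Properties using (Linked⇒All)
open import Data.Product using (_×_; _,_; proj₁; proj₂; ∃-syntax; Σ-syntax)
open import Data.Sum using (_⊎_; inj₁; inj₂)
open import Level using (0ℓ)
open import Function using (_∘_; flip)
open import Relation.Binary.PropositionalEquality hiding ([_])
open import Relation.Nullary using (¬_; yes; no; ¬?; contradiction)
open import Relation.Unary using (Pred; Decidable)

private
  variable
    p x : ℕ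
    xs ys : List ℕ

-- Multiplicities

mult-++ : ∀ p xs ys → mult p (xs ++ ys) ≡ mult p xs + mult p ys
mult-++ p xs ys = trans (cong length (filter-++ (_≟ p) xs ys)) (length-++ (filter (_≟ p) xs))

mult-cons : ∀ p x xs → mult p (x ∷ xs) ≡ mult p [ x ] + mult p xs
mult-cons p x = mult-++ p [ x ]

mult-[p] : ∀ p → mult p [ p ] ≡ 1
mult-[p] p = cong length (filter-accept (_≟ p) refl)

mult-[x] : x ≢ p → mult p [ x ] ≡ 0
mult-[x] {p = p} x≢p = cong length (filter-reject (_≟ p) x≢p)

mult-here : ∀ p xs → mult p (p ∷ xs) ≡ suc (mult p xs)
mult-here p xs = trans (mult-cons p p xs) (cong (_+ mult p xs) (mult-[p] p))

mult-there : x ≢ p → ∀ xs → mult p (x ∷ xs) ≡ mult p xs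
mult-there {x} {p} x≢p xs = trans (mult-cons p x xs) (cong (_+ mult p xs) (mult-[x] x≢p))

mult-replicate : ∀ p n x → mult p (replicate n x) ≡ n * mult p [ x ]
mult-replicate p zero x = refl
mult-replicate p (suc n) x = trans (mult-cons p x (replicate n x)) (cong (mult p [ x ] +_) (mult-replicate p n x))

mult-replicate-++ : ∀ p n x ys → mult p (replicate n x ++ ys) ≡ n * mult p [ x ] + mult p ys
mult-replicate-++ p n x ys = trans (mult-++ p (replicate n x) ys) (cong (_+ mult p ys) (mult-replicate p n x))

mult≢0⇒∈ : mult p xs ≢ 0 → p ∈ xs
mult≢0⇒∈ {p} {[]} m≢0 = contradiction refl m≢0
mult≢0⇒∈ {p} {x ∷ xs} m≢0 with x ≟ p
... | yes x≡p = here (sym x≡p)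
... | no x≢p = there (mult≢0⇒∈ (m≢0 ∘ trans (mult-there x≢p xs)))

∈⇒mult≢0 : p ∈ xs → mult p xs ≢ 0
∈⇒mult≢0 {p} (here {xs = xs} refl) = subst (_≢ 0) (sym (mult-here p xs)) 1+n≢0
∈⇒mult≢0 {p} (there {x = x} {xs = xs} p∈xs) with x ≟ p
... | yes refl = subst (_≢ 0) (sym (mult-here p xs)) 1+n≢0
... | no x≢p = subst (_≢ 0) (sym (mult-there x≢p xs)) (∈⇒mult≢0 p∈xs)

∉⇒mult≡0 : ¬ (p ∈ xs) → mult p xs ≡ 0
∉⇒mult≡0 {p} {xs} p∉xs with mult p xs ≟ 0
... | yes m≡0 = m≡0
... | no m≢0 = contradiction (mult≢0⇒∈ m≢0) p∉xs

positive⇒mult0≡0 : All (0 <_) xs → mult 0 xs ≡ 0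
positive⇒mult0≡0 pos = ∉⇒mult≡0 λ 0∈xs → <-irrefl refl (All.lookup pos 0∈xs)

mult0≡0⇒positive : mult 0 xs ≡ 0 → All (0 <_) xs
mult0≡0⇒positive m≡0 = All.tabulate λ x∈xs → n≢0⇒n>0 λ { refl → ∈⇒mult≢0 x∈xs m≡0 }

∈⇒≤sum : x ∈ xs → x ≤ sum xs
∈⇒≤sum (here refl) = m≤m+n _ _
∈⇒≤sum (there {x = y} x∈xs) = ≤-trans (∈⇒≤sum x∈xs) (m≤n+m _ y)

module _ {P : Pred ℕ 0ℓ} (P? : Decidable P) where

  mult-filter-accept : P p → ∀ xs → mult p (filter P? xs) ≡ mult p xs
  mult-filter-accept Pp [] = refl
  mult-filter-accept {p} Pp (x ∷ xs) with P? x
  ... | yes _ = trans (mult-cons p x (filter P? xs)) (trans (cong (mult p [ x ] +_) (mult-filter-accept Pp xs))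
                                              (sym (mult-cons p x xs)))
  ... | no ¬Px = trans (mult-filter-accept Pp xs) (sym (mult-there {x} (λ { refl → ¬Px Pp }) xs))

  mult-filter-reject : ¬ P p → ∀ xs → mult p (filter P? xs) ≡ 0
  mult-filter-reject ¬Pp [] = refl
  mult-filter-reject {p} ¬Pp (x ∷ xs) with P? x
  ... | yes Px = trans (mult-there {x} (λ { refl → ¬Pp Px }) (filter P? xs)) (mult-filter-reject ¬Pp xs)
  ... | no _ = mult-filter-reject ¬Pp xs

mult-↭ : ∀ p → xs ↭ ys → mult p xs ≡ mult p ys
mult-↭ p xs↭ys = ↭-length (filter-↭ (_≟ p) xs↭ys)

mult-deduplicate : ∀ p xs → mult p (deduplicate _≟_ xs) ≡ 1 ⊓ mult p xs
mult-deduplicate p [] = refl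
mult-deduplicate p (x ∷ xs) with x ≟ p
... | yes refl = begin
  mult x (x ∷ F)        ≡⟨ mult-here x F ⟩
  suc (mult x F)        ≡⟨ cong suc (mult-filter-reject (¬? ∘ (x ≟_)) (λ x≢x → x≢x refl) D) ⟩
  1                     ≡⟨ cong (1 ⊓_) (mult-here x xs) ⟨
  1 ⊓ mult x (x ∷ xs)   ∎
  where
  open ≡-Reasoning
  D = deduplicate _≟_ xs
  F = filter (¬? ∘ (x ≟_)) D
... | no x≢p = begin
  mult p (x ∷ F)        ≡⟨ mult-there x≢p F ⟩
  mult p F              ≡⟨ mult-filter-accept (¬? ∘ (x ≟_)) x≢p D ⟩
  mult p D              ≡⟨ mult-deduplicate p xs ⟩
  1 ⊓ mult p xs         ≡⟨ cong (1 ⊓_) (mult-there x≢p xs) ⟨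
  1 ⊓ mult p (x ∷ xs)   ∎
  where
  open ≡-Reasoning
  D = deduplicate _≟_ xs
  F = filter (¬? ∘ (x ≟_)) D

-- Non-increasing lists

insertDesc-↭ : ∀ x ys → insertDesc x ys ↭ x ∷ ys
insertDesc-↭ x [] = ↭-refl
insertDesc-↭ x (y ∷ ys) with y ≤? x
... | yes _ = ↭-refl
... | no _ = ↭-trans (prep y (insertDesc-↭ x ys)) (swap y x ↭-refl)

sortDesc-↭ : ∀ xs → sortDesc xs ↭ xs
sortDesc-↭ [] = ↭-refl
sortDesc-↭ (x ∷ xs) = ↭-trans (insertDesc-↭ x (sortDesc xs)) (prep x (sortDesc-↭ xs))

insertDesc-sorted : ∀ x ys → Linked _≥_ ys → Linked _≥_ (insertDesc x ys)
insertDesc-sorted x [] _ = [-]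
insertDesc-sorted x (y ∷ ys) ys↘ with y ≤? x
... | yes y≤x = y≤x ∷ ys↘
... | no y≰x = below (<⇒≤ (≰⇒> y≰x)) ys↘
  where
  below : ∀ {y ys} → x ≤ y → Linked _≥_ (y ∷ ys) → Linked _≥_ (y ∷ insertDesc x ys)
  below {y} {[]} x≤y _ = x≤y ∷ [-]
  below {y} {z ∷ zs} x≤y (y≥z ∷ zs↘) with z ≤? x
  ... | yes z≤x = x≤y ∷ z≤x ∷ zs↘
  ... | no z≰x = y≥z ∷ below (<⇒≤ (≰⇒> z≰x)) zs↘

sortDesc-sorted : ∀ xs → Linked _≥_ (sortDesc xs)
sortDesc-sorted [] = []
sortDesc-sorted (x ∷ xs) = insertDesc-sorted x (sortDesc xs) (sortDesc-sorted xs)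

fromMult : (ℕ → ℕ) → ℕ → List ℕ
fromMult f zero = []
fromMult f (suc b) = replicate (f (suc b)) (suc b) ++ fromMult f b

fromMult-bounded : ∀ f b → All (λ x → 0 < x × x ≤ b) (fromMult f b)
fromMult-bounded f zero = []
fromMult-bounded f (suc b) = ++⁺ (replicate⁺ (f (suc b)) (z<s , ≤-refl))
                                 (All.map (λ (0<x , x≤b) → 0<x , m≤n⇒m≤1+n x≤b) (fromMult-bounded f b))

fromMult-sorted : ∀ f b → Linked _≥_ (fromMult f b)
fromMult-sorted f zero = []
fromMult-sorted f (suc b) = replicate-++-sorted (f (suc b))
  (All.map (λ (_ , x≤b) → m≤n⇒m≤1+n x≤b) (fromMult-bounded f b)) (fromMult-sorted f b)
  where
  replicate-++-sorted : ∀ {x ys} n → All (_≤ x) ys → Linked _≥_ ys → Linked _≥_ (replicate n x ++ ys)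
  replicate-++-sorted zero _ ys↘ = ys↘
  replicate-++-sorted {ys = []} (suc zero) _ _ = [-]
  replicate-++-sorted {ys = y ∷ ys} (suc zero) (y≤x ∷ _) ys↘ = y≤x ∷ ys↘
  replicate-++-sorted (suc (suc n)) below ys↘ = ≤-refl ∷ replicate-++-sorted (suc n) below ys↘

mult-fromMult-outside : ∀ f b {p} → ¬ (0 < p × p ≤ b) → mult p (fromMult f b) ≡ 0
mult-fromMult-outside f b out = ∉⇒mult≡0 λ p∈ → out (All.lookup (fromMult-bounded f b) p∈)

mult-fromMult-inside : ∀ f {b p} → 0 < p → p ≤ b → mult p (fromMult f b) ≡ f p
mult-fromMult-inside f {zero} 0<p p≤0 = contradiction p≤0 (<⇒≱ 0<p)
mult-fromMult-inside f {suc b} {p} 0<p p≤1+b with p ≟ suc b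
... | yes refl = begin
  mult p (replicate (f p) p ++ fromMult f b)  ≡⟨ mult-replicate-++ p (f p) p (fromMult f b) ⟩
  f p * mult p [ p ] + mult p (fromMult f b)  ≡⟨ cong₂ (λ a c → f p * a + c) (mult-[p] p)
                                                   (mult-fromMult-outside f b λ (_ , p≤b) → <-irrefl refl p≤b) ⟩
  f p * 1 + 0                                 ≡⟨ trans (+-identityʳ _) (*-identityʳ (f p)) ⟩
  f p                                         ∎
  where open ≡-Reasoning
... | no p≢1+b = begin
  mult p (replicate (f (suc b)) (suc b) ++ fromMult f b) ≡⟨ mult-replicate-++ p (f (suc b)) (suc b) (fromMult f b) ⟩
  f (suc b) * mult p [ suc b ] + mult p (fromMult f b)   ≡⟨ cong₂ (λ a c → f (suc b) * a + c) (mult-[x] (p≢1+b ∘ sym))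
                                                              (mult-fromMult-inside f 0<p (≤-pred (≤∧≢⇒< p≤1+b p≢1+b))) ⟩
  f (suc b) * 0 + f p                                    ≡⟨ cong (_+ f p) (*-zeroʳ (f (suc b))) ⟩
  f p                                                    ∎
  where open ≡-Reasoning

mult-fromMult : ∀ f b → f 0 ≡ 0 → (∀ p → b < p → f p ≡ 0) → ∀ p → mult p (fromMult f b) ≡ f p
mult-fromMult f b f0≡0 f-bounded p with p ≟ 0 | p ≤? b
... | yes refl | _ = trans (mult-fromMult-outside f b λ (0<0 , _) → <-irrefl refl 0<0) (sym f0≡0)
... | no p≢0 | yes p≤b = mult-fromMult-inside f (n≢0⇒n>0 p≢0) p≤b
... | no _ | no p≰b = trans (mult-fromMult-outside f b λ (_ , p≤b) → p≰b p≤b) (sym (f-bounded p (≰⇒> p≰b)))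

sorted-≡ : Linked _≥_ xs → Linked _≥_ ys → (∀ p → mult p xs ≡ mult p ys) → xs ≡ ys
sorted-≡ {[]} {[]} _ _ _ = refl
sorted-≡ {[]} {y ∷ ys} _ _ same = contradiction (trans (same y) (mult-here y ys)) (λ ())
sorted-≡ {x ∷ xs} {[]} _ _ same = contradiction (trans (sym (same x)) (mult-here x xs)) (λ ())
sorted-≡ {x ∷ xs} {y ∷ ys} xs↘ ys↘ same =
  cong₂ _∷_ x≡y (sorted-≡ (Linked.tail xs↘) (Linked.tail ys↘) same-tail)
  where
  head-≥ : ∀ {z zs} → Linked _≥_ (z ∷ zs) → ∀ {w} → w ∈ z ∷ zs → z ≥ w
  head-≥ zs↘ = All.lookup (Linked⇒All (flip ≤-trans) ≤-refl zs↘)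
  present : ∀ {zs zs′} z → (∀ p → mult p (z ∷ zs) ≡ mult p zs′) → z ∈ zs′
  present {zs} {zs′} z same′ = mult≢0⇒∈ {z} {zs′} (∈⇒mult≢0 {z} {z ∷ zs} (here refl) ∘ trans (same′ z))
  x≡y : x ≡ y
  x≡y = ≤-antisym (head-≥ ys↘ (present x same)) (head-≥ xs↘ (present y (sym ∘ same)))
  same-tail : ∀ p → mult p xs ≡ mult p ys
  same-tail p = +-cancelˡ-≡ (mult p [ x ]) _ _ (begin
    mult p [ x ] + mult p xs ≡⟨ mult-cons p x xs ⟨
    mult p (x ∷ xs)         ≡⟨ same p ⟩
    mult p (y ∷ ys)         ≡⟨ mult-cons p y ys ⟩
    mult p [ y ] + mult p ys ≡⟨ cong (λ z → mult p [ z ] + mult p ys) x≡y ⟨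
    mult p [ x ] + mult p ys ∎)
    where open ≡-Reasoning

-- Sums over the distinct parts of a list

sum-replicate : ∀ n x → sum (replicate n x) ≡ n * x
sum-replicate zero x = refl
sum-replicate (suc n) x = cong (x +_) (sum-replicate n x)

sum-map-+ : ∀ (f g : ℕ → ℕ) xs → sum (map (λ x → f x + g x) xs) ≡ sum (map f xs) + sum (map g xs)
sum-map-+ f g [] = refl
sum-map-+ f g (x ∷ xs) =
  trans (cong (f x + g x +_) (sum-map-+ f g xs)) (interchange (f x) (g x) (sum (map f xs)) (sum (map g xs)))

sum-map-filter : ∀ (h : ℕ → ℕ) x ys →
  sum (map h ys) ≡ mult x ys * h x + sum (map h (filter (¬? ∘ (x ≟_)) ys))
sum-map-filter h x [] = refl
sum-map-filter h x (y ∷ ys) with x ≟ y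
... | yes refl = begin
  h x + sum (map h ys)                          ≡⟨ cong (h x +_) (sum-map-filter h x ys) ⟩
  h x + (mult x ys * h x + rest ys)             ≡⟨ +-assoc (h x) _ _ ⟨
  suc (mult x ys) * h x + rest ys               ≡⟨ cong₂ (λ m xs → m * h x + sum (map h xs))
                                                     (mult-here x ys) (filter-reject x≢? (λ x≢x → x≢x refl)) ⟨
  mult x (x ∷ ys) * h x + rest (x ∷ ys)         ∎
  where
  open ≡-Reasoning
  x≢? = ¬? ∘ (x ≟_)
  rest = λ xs → sum (map h (filter x≢? xs))
... | no x≢y = begin
  h y + sum (map h ys)                          ≡⟨ cong (h y +_) (sum-map-filter h x ys) ⟩
  h y + (mult x ys * h x + rest ys)             ≡⟨ x∙yz≈y∙xz (h y) (mult x ys * h x) (rest ys) ⟩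
  mult x ys * h x + (h y + rest ys)             ≡⟨ cong₂ (λ m xs → m * h x + sum (map h xs))
                                                     (mult-there (x≢y ∘ sym) ys) (filter-accept x≢? x≢y) ⟨
  mult x (y ∷ ys) * h x + rest (y ∷ ys)         ∎
  where
  open ≡-Reasoning
  x≢? = ¬? ∘ (x ≟_)
  rest = λ xs → sum (map h (filter x≢? xs))

Σparts : (ℕ → ℕ → ℕ) → List ℕ → ℕ
Σparts G xs = sum (map (λ k → G k (mult k xs)) (deduplicate _≟_ xs))

Σparts-cong : ∀ G H xs → (∀ k → G k (mult k xs) ≡ H k (mult k xs)) → Σparts G xs ≡ Σparts H xs
Σparts-cong G H xs G≗H = cong sum (map-cong G≗H (deduplicate _≟_ xs))

Σparts-+ : ∀ G H xs → Σparts (λ k m → G k m + H k m) xs ≡ Σparts G xs + Σparts H xs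
Σparts-+ G H xs = sum-map-+ (λ k → G k (mult k xs)) (λ k → H k (mult k xs)) (deduplicate _≟_ xs)

-- Stated additively to avoid truncated subtraction: passing from xs to x ∷ xs replaces the
-- contribution G x m of x by G x (1 + m).
Σparts-cons : ∀ G x xs → G x 0 ≡ 0 →
  Σparts G (x ∷ xs) + G x (mult x xs) ≡ G x (suc (mult x xs)) + Σparts G xs
Σparts-cons G x xs Gx0≡0 = begin
  G x (mult x (x ∷ xs)) + sum (map (λ k → G k (mult k (x ∷ xs))) F) + h x
    ≡⟨ cong₂ (λ a b → G x a + b + h x) (mult-here x xs) (cong sum (map-cong-local
         (All.map (λ {k} x≢k → cong (G k) (mult-there x≢k xs)) (all-filter (¬? ∘ (x ≟_)) D)))) ⟩
  G x (suc m) + sum (map h F) + h x               ≡⟨ xy∙z≈x∙zy (G x (suc m)) (sum (map h F)) (h x) ⟩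
  G x (suc m) + (h x + sum (map h F))             ≡⟨ cong (λ a → G x (suc m) + (a + sum (map h F))) once ⟨
  G x (suc m) + (mult x D * h x + sum (map h F))  ≡⟨ cong (G x (suc m) +_) (sum-map-filter h x D) ⟨
  G x (suc m) + Σparts G xs                       ∎
  where
  open ≡-Reasoning
  D = deduplicate _≟_ xs
  F = filter (¬? ∘ (x ≟_)) D
  h = λ k → G k (mult k xs)
  m = mult x xs
  capped : ∀ n → (1 ⊓ n) * G x n ≡ G x n
  capped zero = sym Gx0≡0
  capped (suc n) = +-identityʳ (G x (suc n))
  once : mult x D * h x ≡ h x
  once = trans (cong (_* h x) (mult-deduplicate x xs)) (capped m)

Σparts-single : ∀ G q → G q 0 ≡ 0 → (∀ k m → k ≢ q → G k m ≡ 0) → ∀ xs → Σparts G xs ≡ G q (mult q xs)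
Σparts-single G q Gq0≡0 off-q [] = sym Gq0≡0
Σparts-single G q Gq0≡0 off-q (x ∷ xs) with x ≟ q
... | yes refl = +-cancelʳ-≡ (G x (mult x xs)) _ _ (begin
  Σparts G (x ∷ xs) + G x (mult x xs)  ≡⟨ Σparts-cons G x xs Gq0≡0 ⟩
  G x (suc (mult x xs)) + Σparts G xs  ≡⟨ cong₂ _+_ (cong (G x) (sym (mult-here x xs)))
                                                     (Σparts-single G x Gq0≡0 off-q xs) ⟩
  G x (mult x (x ∷ xs)) + G x (mult x xs) ∎)
  where open ≡-Reasoning
... | no x≢q = begin
  Σparts G (x ∷ xs)                    ≡⟨ +-identityʳ _ ⟨
  Σparts G (x ∷ xs) + 0                ≡⟨ cong (Σparts G (x ∷ xs) +_) (off-q x (mult x xs) x≢q) ⟨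
  Σparts G (x ∷ xs) + G x (mult x xs)  ≡⟨ Σparts-cons G x xs (off-q x 0 x≢q) ⟩
  G x (suc (mult x xs)) + Σparts G xs  ≡⟨ cong (_+ Σparts G xs) (off-q x _ x≢q) ⟩
  Σparts G xs                          ≡⟨ Σparts-single G q Gq0≡0 off-q xs ⟩
  G q (mult q xs)                      ≡⟨ cong (G q) (mult-there x≢q xs) ⟨
  G q (mult q (x ∷ xs))                ∎
  where open ≡-Reasoning

Σparts-linear : ∀ f xs → Σparts (λ k m → f k * m) xs ≡ sum (map f xs)
Σparts-linear f [] = refl
Σparts-linear f (x ∷ xs) = +-cancelʳ-≡ (f x * mult x xs) _ _ (begin
  Σparts (λ k m → f k * m) (x ∷ xs) + f x * mult x xs ≡⟨ Σparts-cons (λ k m → f k * m) x xs (*-zeroʳ (f x)) ⟩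
  f x * suc (mult x xs) + Σparts (λ k m → f k * m) xs ≡⟨ cong₂ _+_ (*-suc (f x) (mult x xs)) (Σparts-linear f xs) ⟩
  f x + f x * mult x xs + sum (map f xs)             ≡⟨ xy∙z≈x∙zy (f x) _ _ ⟩
  f x + (sum (map f xs) + f x * mult x xs)           ≡⟨ +-assoc (f x) _ _ ⟨
  f x + sum (map f xs) + f x * mult x xs             ∎)
  where open ≡-Reasoning

Σparts-zero : ∀ G → (∀ k m → G k m ≡ 0) → ∀ xs → Σparts G xs ≡ 0
Σparts-zero G G≡0 xs = trans (Σparts-single G 0 (G≡0 0 0) (λ k m _ → G≡0 k m) xs) (G≡0 0 (mult 0 xs))

Σparts-at : ∀ (c : ℕ → ℕ → ℕ) (part : ℕ → ℕ) {p} q →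
  (∀ k → part k ≡ p → k ≡ q) → part q ≡ p → c q 0 ≡ 0 →
  ∀ xs → Σparts (λ k m → c k m * mult p [ part k ]) xs ≡ c q (mult q xs)
Σparts-at c part {p} q only-q hit cq0≡0 xs = begin
  Σparts (λ k m → c k m * mult p [ part k ]) xs ≡⟨ Σparts-single _ q (cong (_* mult p [ part q ]) cq0≡0) off-q xs ⟩
  c q (mult q xs) * mult p [ part q ]          ≡⟨ cong (λ x → c q (mult q xs) * mult p [ x ]) hit ⟩
  c q (mult q xs) * mult p [ p ]               ≡⟨ cong (c q (mult q xs) *_) (mult-[p] p) ⟩
  c q (mult q xs) * 1                          ≡⟨ *-identityʳ _ ⟩
  c q (mult q xs)                              ∎
  where
  open ≡-Reasoning
  off-q : ∀ k m → k ≢ q → c k m * mult p [ part k ] ≡ 0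
  off-q k m k≢q = trans (cong (c k m *_) (mult-[x] (k≢q ∘ only-q k))) (*-zeroʳ (c k m))

Σparts-missed : ∀ (c : ℕ → ℕ → ℕ) (part : ℕ → ℕ) {p} → (∀ k → part k ≢ p) →
  ∀ xs → Σparts (λ k m → c k m * mult p [ part k ]) xs ≡ 0
Σparts-missed c part missed = Σparts-zero _ λ k m → trans (cong (c k m *_) (mult-[x] (missed k))) (*-zeroʳ (c k m))

concatMap-additive : ∀ (h : List ℕ → ℕ) → h [] ≡ 0 → (∀ xs ys → h (xs ++ ys) ≡ h xs + h ys) →
  ∀ (g : ℕ → List ℕ) xs → h (concatMap g xs) ≡ sum (map (h ∘ g) xs)
concatMap-additive h h[]≡0 h-++ g [] = h[]≡0
concatMap-additive h h[]≡0 h-++ g (x ∷ xs) =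
  trans (h-++ (g x) (concatMap g xs)) (cong (h (g x) +_) (concatMap-additive h h[]≡0 h-++ g xs))

-- Parity and division

even-or-odd : ∀ n → n % 2 ≡ 0 ⊎ IsOdd n
even-or-odd n with n % 2 | m%n<n n 2
... | 0 | _ = inj₁ refl
... | 1 | _ = inj₂ refl
... | suc (suc _) | s≤s (s≤s ())

parity-distinct : ∀ {m n} → m % 2 ≡ 0 → IsOdd n → m ≢ n
parity-distinct m-even n-odd refl = 0≢1+n (trans (sym m-even) n-odd)

2*-even : ∀ n → (2 * n) % 2 ≡ 0
2*-even n = trans (cong (_% 2) (*-comm 2 n)) (m*n%n≡0 n 2)

1+2*-odd : ∀ n → IsOdd (suc (2 * n))
1+2*-odd n = trans (cong (λ m → suc m % 2) (*-comm 2 n)) ([m+kn]%n≡m%n 1 n 2)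

*-odd : ∀ {m n} → IsOdd m → IsOdd n → IsOdd (m * n)
*-odd {m} {n} m-odd n-odd = trans (%-distribˡ-* m n 2) (cong₂ (λ a b → (a * b) % 2) m-odd n-odd)

even-half : ∀ {n} → n % 2 ≡ 0 → n ≡ 2 * (n / 2)
even-half {n} n-even = trans (m≡m%n+[m/n]*n n 2) (trans (cong (_+ n / 2 * 2) n-even) (*-comm (n / 2) 2))

odd-half : ∀ {n} → IsOdd n → n ≡ 1 + n / 2 * 2
odd-half {n} n-odd = trans (m≡m%n+[m/n]*n n 2) (cong (_+ n / 2 * 2) n-odd)

[t+qn]%n≡t : ∀ {t} q n .{{_ : NonZero n}} → t < n → (t + q * n) % n ≡ t
[t+qn]%n≡t {t} q n t<n = trans ([m+kn]%n≡m%n t q n) (m<n⇒m%n≡m t<n)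

[t+qn]/n≡q : ∀ {t} q n .{{_ : NonZero n}} → t < n → (t + q * n) / n ≡ q
[t+qn]/n≡q {t} q n t<n = begin
  (t + q * n) / n   ≡⟨ +-distrib-/ t (q * n) (subst (_< n) (sym remainders) t<n) ⟩
  t / n + q * n / n ≡⟨ cong₂ _+_ (m<n⇒m/n≡0 t<n) (m*n/n≡m q n) ⟩
  q                 ∎
  where
  open ≡-Reasoning
  remainders : t % n + q * n % n ≡ t
  remainders = trans (cong₂ _+_ (m<n⇒m%n≡m t<n) (m*n%n≡0 q n)) (+-identityʳ t)

-- Blocks of β

module _ (r : ℕ) where

  private
    R : ℕ
    R = suc (2 * r)

  Admissible : ℕ → Set
  Admissible m = IsOdd m → R ≤ m

  doublesBy : ℕ → ℕ → ℕ
  doublesBy v 1 = r + v + 1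
  doublesBy v _ = v

  doubles : ℕ → ℕ
  doubles m = doublesBy (m % R / 2) (m % R % 2)

  bundles : ℕ → ℕ
  bundles m = (m ∸ 2 * doubles m) / R

  twice-doubles : ∀ m → 2 * doubles m ≡ m % R ⊎ (IsOdd (m % R) × 2 * doubles m ≡ m % R + R)
  twice-doubles m = byRemainder (m % R)
    where
    byRemainder : ∀ s → 2 * doublesBy (s / 2) (s % 2) ≡ s ⊎ (IsOdd s × 2 * doublesBy (s / 2) (s % 2) ≡ s + R)
    byRemainder s with s % 2 | s / 2 | m≡m%n+[m/n]*n s 2 | m%n<n s 2
    ... | 0 | v | s≡ | _ = inj₁ (trans (*-comm 2 v) (sym s≡))
    ... | 1 | v | s≡ | _ = inj₂ (refl , trans (2[r+v+1]≡s+R r v) (cong (_+ R) (sym s≡)))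
      where
      2[r+v+1]≡s+R : ∀ r v → 2 * (r + v + 1) ≡ 1 + v * 2 + suc (2 * r)
      2[r+v+1]≡s+R = solve-∀
    ... | suc (suc _) | _ | _ | s≤s (s≤s ())

  doubles<R : ∀ m → doubles m < R
  doubles<R m = *-cancelˡ-< 2 (doubles m) R (twice<2R (twice-doubles m))
    where
    s<R = m%n<n m R
    twice<2R : 2 * doubles m ≡ m % R ⊎ (IsOdd (m % R) × 2 * doubles m ≡ m % R + R) → 2 * doubles m < 2 * R
    twice<2R (inj₁ e) = subst (_< 2 * R) (sym e) (<-≤-trans s<R (m≤n*m R 2))
    twice<2R (inj₂ (_ , e)) = subst (_< 2 * R) (sym e)
      (subst (m % R + R <_) (cong (R +_) (sym (+-identityʳ R))) (+-monoˡ-< R s<R))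

  bundles-≡ : ∀ {m} c → m ≡ c * R + 2 * doubles m → bundles m ≡ c
  bundles-≡ {m} c m≡ = begin
    (m ∸ 2 * doubles m) / R                     ≡⟨ cong (λ n → (n ∸ 2 * doubles m) / R) m≡ ⟩
    (c * R + 2 * doubles m ∸ 2 * doubles m) / R ≡⟨ cong (_/ R) (m+n∸n≡m (c * R) (2 * doubles m)) ⟩
    c * R / R                                   ≡⟨ m*n/n≡m c R ⟩
    c                                           ∎
    where open ≡-Reasoning

  -- For odd remainder s, 2·doubles = s + (2r+1) spends one quotient unit, which exists by admissibility.
  ∃-decomposition : ∀ {m} → Admissible m → ∃[ c ] m ≡ c * R + 2 * doubles m
  ∃-decomposition {m} admissible = byQuotient (twice-doubles m) (m / R) (m≡m%n+[m/n]*n m R)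
    where
    byQuotient : 2 * doubles m ≡ m % R ⊎ (IsOdd (m % R) × 2 * doubles m ≡ m % R + R) →
      ∀ q → m ≡ m % R + q * R → ∃[ c ] m ≡ c * R + 2 * doubles m
    byQuotient (inj₁ e) q m≡ = q , trans m≡ (trans (+-comm (m % R) (q * R)) (cong (q * R +_) (sym e)))
    byQuotient (inj₂ (s-odd , _)) zero m≡ =
      contradiction (admissible (subst IsOdd (sym m≡′) s-odd)) (<⇒≱ (subst (_< R) (sym m≡′) (m%n<n m R)))
      where m≡′ = trans m≡ (+-identityʳ (m % R))
    byQuotient (inj₂ (_ , e)) (suc q) m≡ = q , trans m≡ (trans (shift (m % R) q R) (cong (q * R +_) (sym e)))
      where
      shift : ∀ s q R → s + (R + q * R) ≡ q * R + (s + R)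
      shift = solve-∀

  decomposition : ∀ {m} → Admissible m → m ≡ bundles m * R + 2 * doubles m
  decomposition {m} admissible with c , m≡ ← ∃-decomposition admissible =
    trans m≡ (cong (λ c → c * R + 2 * doubles m) (sym (bundles-≡ c m≡)))

  doubles-unique : ∀ c {d} → d ≤ 2 * r → doubles (c * R + 2 * d) ≡ d
  doubles-unique c {d} d≤2r = *-cancelˡ-≡ (doubles M) d 2 (agree (twice-doubles M) below-2R)
    where
    M = c * R + 2 * d
    t = 2 * d % R
    M%R≡t : M % R ≡ t
    M%R≡t = trans (cong (_% R) (+-comm (c * R) (2 * d))) ([m+kn]%n≡m%n (2 * d) c R)
    below-2R : 2 * d ≡ t ⊎ 2 * d ≡ t + R
    below-2R with 2 * d / R | m≡m%n+[m/n]*n (2 * d) R | m<n*o⇒m/o<n {n = 2} (*-monoʳ-< 2 (s≤s d≤2r))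
    ... | 0 | e | _ = inj₁ (trans e (+-identityʳ t))
    ... | 1 | e | _ = inj₂ (trans e (cong (t +_) (+-identityʳ R)))
    ... | suc (suc _) | _ | s≤s (s≤s ())
    agree : 2 * doubles M ≡ M % R ⊎ (IsOdd (M % R) × 2 * doubles M ≡ M % R + R) →
            2 * d ≡ t ⊎ 2 * d ≡ t + R → 2 * doubles M ≡ 2 * d
    agree (inj₁ e) (inj₁ e′) = trans e (trans M%R≡t (sym e′))
    agree (inj₂ (_ , e)) (inj₂ e′) = trans e (trans (cong (_+ R) M%R≡t) (sym e′))
    agree (inj₁ e) (inj₂ e′) = contradiction
      (trans e′ (trans (cong (_+ R) (trans (sym M%R≡t) (sym e))) (2a+R≡1+2[a+r] (doubles M) r)))
      (even≢odd d (doubles M + r))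
      where
      2a+R≡1+2[a+r] : ∀ a r → 2 * a + suc (2 * r) ≡ suc (2 * (a + r))
      2a+R≡1+2[a+r] = solve-∀
    agree (inj₂ (s-odd , _)) (inj₁ e′) = contradiction e′ (parity-distinct (2*-even d) (subst IsOdd M%R≡t s-odd))

  bundles-unique : ∀ c {d} → d ≤ 2 * r → bundles (c * R + 2 * d) ≡ c
  bundles-unique c {d} d≤2r = bundles-≡ c (cong (λ d → c * R + 2 * d) (sym (doubles-unique c d≤2r)))

  admissible-decomposed : ∀ c d → Admissible (c * R + 2 * d)
  admissible-decomposed zero d odd = contradiction refl (parity-distinct {2 * d} (2*-even d) odd)
  admissible-decomposed (suc c) d _ = ≤-trans (m≤m+n R (c * R)) (m≤m+n (suc c * R) (2 * d))

  keptPartBy : ℕ → ℕ → ℕ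
  keptPartBy k 0 = k
  keptPartBy k _ = R * k

  keptCountBy : ℕ → ℕ → ℕ → ℕ
  keptCountBy m d 0 = m ∸ 2 * d
  keptCountBy m d _ = (m ∸ 2 * d) / R

  keptPart : ℕ → ℕ
  keptPart k = keptPartBy k (k % 2)

  keptCount : ℕ → ℕ → ℕ
  keptCount k m = keptCountBy m (doubles m) (k % 2)

  private
    2r+2v+2≡2[r+v+1] : ∀ r v → 2 * r + 2 * v + 2 ≡ 2 * (r + v + 1)
    2r+2v+2≡2[r+v+1] = solve-∀

  assign-≡ : ∀ k m → assign r k m ≡ replicate (keptCount k m) (keptPart k) ++ replicate (doubles m) (2 * k)
  assign-≡ k m with k % 2 | m % R % 2
  ... | 0 | 0 = refl
  ... | 0 | 1 = cong (λ n → replicate (m ∸ n) k ++ replicate (r + m % R / 2 + 1) (2 * k))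
                     (2r+2v+2≡2[r+v+1] r (m % R / 2))
  ... | 0 | suc (suc _) = refl
  ... | suc _ | 0 = refl
  ... | suc _ | 1 = cong (λ n → replicate ((m ∸ n) / R) (R * k) ++ replicate (r + m % R / 2 + 1) (2 * k))
                         (2r+2v+2≡2[r+v+1] r (m % R / 2))
  ... | suc _ | suc (suc _) = refl

  keptCount-zero : ∀ k → keptCount k 0 ≡ 0
  keptCount-zero k with k % 2
  ... | 0 = refl
  ... | suc _ = refl

  keptPart-even : ∀ k → k % 2 ≡ 0 → keptPart k ≡ k
  keptPart-even k = cong (keptPartBy k)

  keptPart-odd : ∀ k → IsOdd k → keptPart k ≡ R * k
  keptPart-odd k = cong (keptPartBy k)

  keptCount-even : ∀ k {m} → k % 2 ≡ 0 → Admissible m → keptCount k m ≡ bundles m * R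
  keptCount-even k {m} k-even admissible = begin
    keptCount k m                                   ≡⟨ cong (keptCountBy m (doubles m)) k-even ⟩
    m ∸ 2 * doubles m                               ≡⟨ cong (_∸ 2 * doubles m) (decomposition admissible) ⟩
    bundles m * R + 2 * doubles m ∸ 2 * doubles m   ≡⟨ m+n∸n≡m (bundles m * R) (2 * doubles m) ⟩
    bundles m * R                                   ∎
    where open ≡-Reasoning

  keptCount-odd : ∀ k m → IsOdd k → keptCount k m ≡ bundles m
  keptCount-odd k m = cong (keptCountBy m (doubles m))

  keptContribution doubledContribution : ℕ → ℕ → ℕ → ℕ
  keptContribution p k m = keptCount k m * mult p [ keptPart k ]
  doubledContribution p k m = doubles m * mult p [ 2 * k ]

  mult-assign : ∀ p k m → mult p (assign r k m) ≡ keptContribution p k m + doubledContribution p k m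
  mult-assign p k m = begin
    mult p (assign r k m)                                              ≡⟨ cong (mult p) (assign-≡ k m) ⟩
    mult p (replicate (keptCount k m) (keptPart k) ++ replicate (doubles m) (2 * k))
      ≡⟨ mult-replicate-++ p (keptCount k m) (keptPart k) (replicate (doubles m) (2 * k)) ⟩
    keptCount k m * mult p [ keptPart k ] + mult p (replicate (doubles m) (2 * k))
      ≡⟨ cong (keptCount k m * mult p [ keptPart k ] +_) (mult-replicate p (doubles m) (2 * k)) ⟩
    keptContribution p k m + doubledContribution p k m                 ∎
    where open ≡-Reasoning

  sum-assign : ∀ k {m} → Admissible m → sum (assign r k m) ≡ k * m
  sum-assign k {m} admissible = begin
    sum (assign r k m)                                       ≡⟨ cong sum (assign-≡ k m) ⟩
    sum (replicate (keptCount k m) (keptPart k) ++ replicate (doubles m) (2 * k))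
      ≡⟨ sum-++ (replicate (keptCount k m) (keptPart k)) (replicate (doubles m) (2 * k)) ⟩
    sum (replicate (keptCount k m) (keptPart k)) + sum (replicate (doubles m) (2 * k))
      ≡⟨ cong₂ _+_ (sum-replicate (keptCount k m) (keptPart k)) (sum-replicate (doubles m) (2 * k)) ⟩
    keptCount k m * keptPart k + doubles m * (2 * k) ≡⟨ cong (_+ doubles m * (2 * k)) (kept-weight (even-or-odd k)) ⟩
    bundles m * R * k + doubles m * (2 * k)          ≡⟨ weights (bundles m) R (doubles m) k ⟩
    k * (bundles m * R + 2 * doubles m)              ≡⟨ cong (k *_) (decomposition admissible) ⟨
    k * m                                            ∎
    where
    open ≡-Reasoning
    weights : ∀ c R d k → c * R * k + d * (2 * k) ≡ k * (c * R + 2 * d)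
    weights = solve-∀
    kept-weight : k % 2 ≡ 0 ⊎ IsOdd k → keptCount k m * keptPart k ≡ bundles m * R * k
    kept-weight (inj₁ k-even) = cong₂ _*_ (keptCount-even k k-even admissible) (keptPart-even k k-even)
    kept-weight (inj₂ k-odd) = trans (cong₂ _*_ (keptCount-odd k m k-odd) (keptPart-odd k k-odd))
                                     (sym (*-assoc (bundles m) R k))

  -- Multiplicities in the image of β

  mult-β : ∀ p xs → mult p (β r xs) ≡ Σparts (keptContribution p) xs + Σparts (doubledContribution p) xs
  mult-β p xs = begin
    mult p (β r xs)                                                    ≡⟨ mult-↭ p (sortDesc-↭ (concatMap block D)) ⟩
    mult p (concatMap block D)                                         ≡⟨ concatMap-additive (mult p) refl (mult-++ p) block D ⟩
    Σparts (λ k m → mult p (assign r k m)) xs                          ≡⟨ Σparts-cong (λ k m → mult p (assign r k m)) summands xs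
                                                                            (λ k → mult-assign p k (mult k xs)) ⟩
    Σparts summands xs                                                 ≡⟨ Σparts-+ (keptContribution p) (doubledContribution p) xs ⟩
    Σparts (keptContribution p) xs + Σparts (doubledContribution p) xs ∎
    where
    open ≡-Reasoning
    D = deduplicate _≟_ xs
    block = λ k → assign r k (mult k xs)
    summands = λ k m → keptContribution p k m + doubledContribution p k m

  sum-β : ∀ xs → (∀ k → Admissible (mult k xs)) → sum (β r xs) ≡ sum xs
  sum-β xs admissible = begin
    sum (β r xs)                             ≡⟨ sum-↭ (sortDesc-↭ (concatMap block D)) ⟩
    sum (concatMap block D)                  ≡⟨ concatMap-additive sum refl sum-++ block D ⟩
    Σparts (λ k m → sum (assign r k m)) xs   ≡⟨ Σparts-cong (λ k m → sum (assign r k m)) (λ k m → k * m) xs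
                                                              (λ k → sum-assign k (admissible k)) ⟩
    Σparts (λ k m → k * m) xs                ≡⟨ Σparts-linear (λ k → k) xs ⟩
    sum (map (λ k → k) xs)                   ≡⟨ cong sum (map-id xs) ⟩
    sum xs                                   ∎
    where
    open ≡-Reasoning
    D = deduplicate _≟_ xs
    block = λ k → assign r k (mult k xs)

  R*-odd : ∀ k → IsOdd k → IsOdd (R * k)
  R*-odd k = *-odd {R} {k} (1+2*-odd r)

  mult-β-even : ∀ j xs → Admissible (mult (2 * j) xs) →
    mult (2 * j) (β r xs) ≡ doubles (mult j xs) + bundles (mult (2 * j) xs) * R
  mult-β-even j xs admissible = begin
    mult (2 * j) (β r xs)                                          ≡⟨ mult-β (2 * j) xs ⟩
    Σparts (keptContribution (2 * j)) xs + Σparts (doubledContribution (2 * j)) xs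
      ≡⟨ cong₂ _+_ (Σparts-at keptCount keptPart (2 * j) only-2j (keptPart-even (2 * j) (2*-even j))
                              (keptCount-zero (2 * j)) xs)
                   (Σparts-at (λ _ → doubles) (2 *_) j (λ k → *-cancelˡ-≡ k j 2) refl refl xs) ⟩
    keptCount (2 * j) (mult (2 * j) xs) + doubles (mult j xs)
      ≡⟨ cong (_+ doubles (mult j xs)) (keptCount-even (2 * j) (2*-even j) admissible) ⟩
    bundles (mult (2 * j) xs) * R + doubles (mult j xs)
      ≡⟨ +-comm (bundles (mult (2 * j) xs) * R) (doubles (mult j xs)) ⟩
    doubles (mult j xs) + bundles (mult (2 * j) xs) * R             ∎
    where
    open ≡-Reasoning
    only-2j : ∀ k → keptPart k ≡ 2 * j → k ≡ 2 * j
    only-2j k hit with even-or-odd k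
    ... | inj₁ k-even = trans (sym (keptPart-even k k-even)) hit
    ... | inj₂ k-odd = contradiction (trans (sym hit) (keptPart-odd k k-odd)) (parity-distinct (2*-even j) (R*-odd k k-odd))

  mult-β-odd : ∀ {k} xs → IsOdd k → mult (R * k) (β r xs) ≡ bundles (mult k xs)
  mult-β-odd {k} xs k-odd = begin
    mult (R * k) (β r xs)                   ≡⟨ mult-β (R * k) xs ⟩
    Σparts (keptContribution (R * k)) xs + Σparts (doubledContribution (R * k)) xs
      ≡⟨ cong₂ _+_ (Σparts-at keptCount keptPart k only-k (keptPart-odd k k-odd) (keptCount-zero k) xs)
                   (Σparts-missed (λ _ → doubles) (2 *_) (λ k′ → parity-distinct (2*-even k′) (R*-odd k k-odd)) xs) ⟩
    keptCount k (mult k xs) + 0             ≡⟨ +-identityʳ _ ⟩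
    keptCount k (mult k xs)                 ≡⟨ keptCount-odd k (mult k xs) k-odd ⟩
    bundles (mult k xs)                     ∎
    where
    open ≡-Reasoning
    only-k : ∀ k′ → keptPart k′ ≡ R * k → k′ ≡ k
    only-k k′ hit with even-or-odd k′
    ... | inj₁ k′-even =
      contradiction (trans (sym (keptPart-even k′ k′-even)) hit) (parity-distinct k′-even (R*-odd k k-odd))
    ... | inj₂ k′-odd = *-cancelˡ-≡ k′ k R (trans (sym (keptPart-odd k′ k′-odd)) hit)

  odd-multiple-mod : ∀ k → IsOdd k → R * k % suc (suc (4 * r)) ≡ R
  odd-multiple-mod k k-odd = trans (cong (_% suc (suc (4 * r))) Rk≡) ([t+qn]%n≡t (k / 2) _ R<2R)
    where
    R<2R : R < suc (suc (4 * r))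
    R<2R = s≤s (s≤s (*-monoˡ-≤ r {2} {4} (s≤s (s≤s z≤n))))
    rearrange : ∀ r t → suc (2 * r) * (1 + t * 2) ≡ suc (2 * r) + t * suc (suc (4 * r))
    rearrange = solve-∀
    Rk≡ : R * k ≡ R + k / 2 * suc (suc (4 * r))
    Rk≡ = trans (cong (R *_) (odd-half k-odd)) (rearrange r (k / 2))

  mod-odd-multiple : ∀ {p} → p % suc (suc (4 * r)) ≡ R → ∃[ k ] IsOdd k × R * k ≡ p
  mod-odd-multiple {p} p% = 1 + t * 2 , [m+kn]%n≡m%n 1 t 2 , sym p≡
    where
    t = p / suc (suc (4 * r))
    rearrange : ∀ r t → suc (2 * r) + t * suc (suc (4 * r)) ≡ suc (2 * r) * (1 + t * 2)
    rearrange = solve-∀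
    p≡ : p ≡ R * (1 + t * 2)
    p≡ = trans (m≡m%n+[m/n]*n p (suc (suc (4 * r)))) (trans (cong (_+ t * suc (suc (4 * r))) p%) (rearrange r t))

  mult-β-odd-other : ∀ {p} xs → IsOdd p → p % suc (suc (4 * r)) ≢ R → mult p (β r xs) ≡ 0
  mult-β-odd-other {p} xs p-odd p%≢R = trans (mult-β p xs) (cong₂ _+_
    (Σparts-missed keptCount keptPart missed xs)
    (Σparts-missed (λ _ → doubles) (2 *_) (λ k → parity-distinct (2*-even k) p-odd) xs))
    where
    missed : ∀ k → keptPart k ≢ p
    missed k hit with even-or-odd k
    ... | inj₁ k-even = parity-distinct k-even p-odd (trans (sym (keptPart-even k k-even)) hit)
    ... | inj₂ k-odd = p%≢R (subst (λ p → p % suc (suc (4 * r)) ≡ R) (trans (sym (keptPart-odd k k-odd)) hit)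
                                    (odd-multiple-mod k k-odd))

  β-sorted : ∀ xs → Linked _≥_ (β r xs)
  β-sorted xs = sortDesc-sorted (concatMap (λ k → assign r k (mult k xs)) (deduplicate _≟_ xs))

  InA⇒admissible : ∀ {n xs} → InA n r xs → ∀ k → Admissible (mult k xs)
  InA⇒admissible {xs = xs} (_ , odd-mult) k k-odd with mult k xs ≟ 0
  ... | yes m≡0 = contradiction (trans (sym (cong (_% 2) m≡0)) k-odd) (λ ())
  ... | no m≢0 = odd-mult k (mult≢0⇒∈ m≢0) k-odd

  β-InC : ∀ {n xs} → InA n r xs → InC n r (β r xs)
  β-InC {n} {xs} A@((_ , positive , sum≡n) , _) =
    (β-sorted xs , mult0≡0⇒positive no-zeros , trans (sum-β xs (InA⇒admissible A)) sum≡n) , odd-parts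
    where
    no-zeros : mult 0 (β r xs) ≡ 0
    no-zeros = trans (mult-β-even 0 xs (InA⇒admissible A 0))
                     (cong (λ m → doubles m + bundles m * R) (positive⇒mult0≡0 positive))
    odd-parts : ∀ p → p ∈ β r xs → IsOdd p → p % suc (suc (4 * r)) ≡ R
    odd-parts p p∈β p-odd with p % suc (suc (4 * r)) ≟ R
    ... | yes p% = p%
    ... | no p%≢R = contradiction (mult-β-odd-other xs p-odd p%≢R) (∈⇒mult≢0 p∈β)

  recoveredBundlesBy : List ℕ → ℕ → ℕ → ℕ
  recoveredBundlesBy μ k 0 = mult k μ / R
  recoveredBundlesBy μ k _ = mult (R * k) μ

  recoveredMult : List ℕ → ℕ → ℕ
  recoveredMult μ k = recoveredBundlesBy μ k (k % 2) * R + 2 * (mult (2 * k) μ % R)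

  mult-recovered : ∀ xs → (∀ k → Admissible (mult k xs)) → ∀ k → recoveredMult (β r xs) k ≡ mult k xs
  mult-recovered xs admissible k = begin
    recoveredBundlesBy (β r xs) k (k % 2) * R + 2 * (mult (2 * k) (β r xs) % R)
      ≡⟨ cong₂ (λ c d → c * R + 2 * d) (bundles-recovered (even-or-odd k)) doubles-recovered ⟩
    bundles (mult k xs) * R + 2 * doubles (mult k xs) ≡⟨ decomposition (admissible k) ⟨
    mult k xs                                         ∎
    where
    open ≡-Reasoning
    even-image : ∀ j → mult (2 * j) (β r xs) ≡ doubles (mult j xs) + bundles (mult (2 * j) xs) * R
    even-image j = mult-β-even j xs (admissible (2 * j))
    doubles-recovered : mult (2 * k) (β r xs) % R ≡ doubles (mult k xs)
    doubles-recovered = trans (cong (_% R) (even-image k)) ([t+qn]%n≡t (bundles (mult (2 * k) xs)) R (doubles<R (mult k xs)))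
    bundles-recovered : k % 2 ≡ 0 ⊎ IsOdd k → recoveredBundlesBy (β r xs) k (k % 2) ≡ bundles (mult k xs)
    bundles-recovered (inj₁ k-even) = trans (cong (recoveredBundlesBy (β r xs) k) k-even)
      (subst (λ k → mult k (β r xs) / R ≡ bundles (mult k xs)) (sym (even-half k-even))
             (trans (cong (_/ R) (even-image (k / 2)))
                    ([t+qn]/n≡q (bundles (mult (2 * (k / 2)) xs)) R (doubles<R (mult (k / 2) xs)))))
    bundles-recovered (inj₂ k-odd) = trans (cong (recoveredBundlesBy (β r xs) k) k-odd) (mult-β-odd xs k-odd)

  recoveredMult-decomposed : ∀ μ k →
    doubles (recoveredMult μ k) ≡ mult (2 * k) μ % R × bundles (recoveredMult μ k) ≡ recoveredBundlesBy μ k (k % 2)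
  recoveredMult-decomposed μ k = doubles-unique c d≤2r , bundles-unique c d≤2r
    where
    c = recoveredBundlesBy μ k (k % 2)
    d≤2r = ≤-pred (m%n<n (mult (2 * k) μ) R)

  recoveredMult-zero : ∀ μ k → mult k μ ≡ 0 → mult (R * k) μ ≡ 0 → mult (2 * k) μ ≡ 0 →
    recoveredMult μ k ≡ 0
  recoveredMult-zero μ k zero₁ zeroR zero₂ = cong₂ (λ c d → c * R + 2 * (d % R)) (bundles-zero (k % 2)) zero₂
    where
    bundles-zero : ∀ b → recoveredBundlesBy μ k b ≡ 0
    bundles-zero zero = cong (_/ R) zero₁
    bundles-zero (suc _) = zeroR

  β-injective : ∀ {n n′ xs ys} → InA n r xs → InA n′ r ys → β r xs ≡ β r ys → xs ≡ ys
  β-injective {xs = xs} {ys} A@((xs↘ , _) , _) A′@((ys↘ , _) , _) β≡ = sorted-≡ xs↘ ys↘ λ k → begin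
    mult k xs                  ≡⟨ mult-recovered xs (InA⇒admissible A) k ⟨
    recoveredMult (β r xs) k   ≡⟨ cong (λ μ → recoveredMult μ k) β≡ ⟩
    recoveredMult (β r ys) k   ≡⟨ mult-recovered ys (InA⇒admissible A′) k ⟩
    mult k ys                  ∎
    where open ≡-Reasoning

  recovered-admissible : ∀ {xs} μ → (∀ k → mult k xs ≡ recoveredMult μ k) → ∀ k → Admissible (mult k xs)
  recovered-admissible μ mult≡ k = subst Admissible (sym (mult≡ k))
    (admissible-decomposed (recoveredBundlesBy μ k (k % 2)) (mult (2 * k) μ % R))

  β-recovered : ∀ {n μ xs} → InC n r μ → (∀ k → mult k xs ≡ recoveredMult μ k) → β r xs ≡ μ
  β-recovered {μ = μ} {xs} ((μ↘ , _) , odd-parts) mult≡ = sorted-≡ (β-sorted xs) μ↘ same-mult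
    where
    admissible = recovered-admissible {xs} μ mult≡
    doubles-xs : ∀ k → doubles (mult k xs) ≡ mult (2 * k) μ % R
    doubles-xs k = trans (cong doubles (mult≡ k)) (proj₁ (recoveredMult-decomposed μ k))
    bundles-xs : ∀ k → bundles (mult k xs) ≡ recoveredBundlesBy μ k (k % 2)
    bundles-xs k = trans (cong bundles (mult≡ k)) (proj₂ (recoveredMult-decomposed μ k))
    even-part : ∀ j → mult (2 * j) (β r xs) ≡ mult (2 * j) μ
    even-part j = begin
      mult (2 * j) (β r xs)                                ≡⟨ mult-β-even j xs (admissible (2 * j)) ⟩
      doubles (mult j xs) + bundles (mult (2 * j) xs) * R  ≡⟨ cong₂ (λ d c → d + c * R) (doubles-xs j) bundles-2j ⟩
      mult (2 * j) μ % R + mult (2 * j) μ / R * R          ≡⟨ m≡m%n+[m/n]*n (mult (2 * j) μ) R ⟨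
      mult (2 * j) μ                                       ∎
      where
      open ≡-Reasoning
      bundles-2j : bundles (mult (2 * j) xs) ≡ mult (2 * j) μ / R
      bundles-2j = trans (bundles-xs (2 * j)) (cong (recoveredBundlesBy μ (2 * j)) (2*-even j))
    same-mult : ∀ p → mult p (β r xs) ≡ mult p μ
    same-mult p with even-or-odd p
    ... | inj₁ p-even = subst (λ p → mult p (β r xs) ≡ mult p μ) (sym (even-half p-even)) (even-part (p / 2))
    ... | inj₂ p-odd with p % suc (suc (4 * r)) ≟ R
    ...   | yes p% with k , k-odd , refl ← mod-odd-multiple {p} p% =
      trans (mult-β-odd xs k-odd) (trans (bundles-xs k) (cong (recoveredBundlesBy μ k) k-odd))
    ...   | no p%≢R =
      trans (mult-β-odd-other xs p-odd p%≢R) (sym (∉⇒mult≡0 λ p∈μ → p%≢R (odd-parts p p∈μ p-odd)))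

  β-surjective : ∀ {n μ} → InC n r μ → Σ[ l ∈ List ℕ ] InA n r l × β r l ≡ μ
  β-surjective {n} {μ} C@((_ , μ-positive , sumμ≡n) , _) =
    l , ((fromMult-sorted f n , All.map proj₁ (fromMult-bounded f n) , sum≡n) , (λ k _ → admissible k)) , β≡μ
    where
    f = recoveredMult μ
    absent-above : ∀ {q} → n < q → mult q μ ≡ 0
    absent-above {q} n<q = ∉⇒mult≡0 λ q∈μ → <⇒≱ n<q (subst (q ≤_) sumμ≡n (∈⇒≤sum {xs = μ} q∈μ))
    f0≡0 : f 0 ≡ 0
    f0≡0 = recoveredMult-zero μ 0 μ0≡0 (trans (cong (λ q → mult q μ) (*-zeroʳ R)) μ0≡0) μ0≡0
      where μ0≡0 = positive⇒mult0≡0 μ-positive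
    f-vanishes : ∀ p → n < p → f p ≡ 0
    f-vanishes p n<p = recoveredMult-zero μ p (absent-above n<p)
      (absent-above (<-≤-trans n<p (m≤n*m p R))) (absent-above (<-≤-trans n<p (m≤n*m p 2)))
    l = fromMult f n
    mult-l : ∀ k → mult k l ≡ f k
    mult-l = mult-fromMult f n f0≡0 f-vanishes
    admissible = recovered-admissible {l} μ mult-l
    β≡μ : β r l ≡ μ
    β≡μ = β-recovered {xs = l} C mult-l
    sum≡n : sum l ≡ n
    sum≡n = trans (sym (sum-β l admissible)) (trans (cong sum β≡μ) sumμ≡n)

mainTheorem1 : (r n : ℕ) → 1 ≤ r →
    ((l : List ℕ) → InA n r l → InC n r (β r l))
    × ((l l′ : List ℕ) → InA n r l → InA n r l′ → β r l ≡ β r l′ → l ≡ l′)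
    × ((μ : List ℕ) → InC n r μ → Σ[ l ∈ List ℕ ] (InA n r l × β r l ≡ μ))
mainTheorem1 r n _ = (λ _ → β-InC r) , (λ _ _ → β-injective r) , (λ _ → β-surjective r)
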